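{- For $n\ge1$, the number $\sigma(n)$ of computationally inequivalent pairwise summations on $n$ distinct variables is $\sigma(n)=\frac{n!}{2^{\varepsilon(n)}}$, where $\varepsilon$ is defined by $\varepsilon(1)=0$ and, for $m\ge1$, $\varepsilon(2m)=2\varepsilon(m)+1$ and $\varepsilon(2m+1)=\varepsilon(m)+\varepsilon(m+1)$.
   Context: A summation tree is a rooted full binary tree (every node has $0$ or $2$ children). A summation on $n$ distinct variables is a summation tree with $n$ leaves with a bijective labelling of its leaves by the variables, representing the fully parenthesized sum in which each internal node is the sum of its two children. Two summations are computationally equivalent if one can be obtained from the other by a finite sequence of operations each swapping the two children (with their labelled subtrees) of some internal node. A pairwise-summation tree is a summation tree in which every internal node having $k$ descendant leaves has two children having $\lfloor k/2\rfloor$ and $\lceil k/2\rceil$ descendant leaves respectively; a pairwise summation is a summation whose underlying tree is a pairwise-summation tree. -}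

module Defs where

open import Data.Nat using (ℕ; suc; _+_; ⌊_/2⌋; ⌈_/2⌉)
open import Data.Fin using (Fin)
open import Data.List using (List; []; _∷_; _++_; allFin)
open import Data.List.Relation.Binary.Permutation.Propositional using (_↭_)
open import Data.Product using (Σ; ∃; _×_; _,_; proj₁)
open import Data.Sum using (_⊎_)
open import Relation.Binary.PropositionalEquality using (_≡_)
open import Relation.Binary.Construct.Closure.ReflexiveTransitive using (Star)

data Tree (A : Set) : Set where
  leaf : A → Tree A
  node : Tree A → Tree A → Tree A

size : ∀ {A} → Tree A → ℕ
size (leaf _)   = 1
size (node l r) = size l + size r

leaves : ∀ {A} → Tree A → List A
leaves (leaf a)   = a ∷ []
leaves (node l r) = leaves l ++ leaves r

-- A summation on the n variables Fin n: the leaf labelling is a bijection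
-- onto Fin n, i.e. the leaf labels are a permutation of all of Fin n.
IsSummation : (n : ℕ) → Tree (Fin n) → Set
IsSummation n t = leaves t ↭ allFin n

data IsPairwise {A : Set} : Tree A → Set where
  leaf : ∀ a → IsPairwise (leaf a)
  node : ∀ {l r} →
         ((size l ≡ ⌊ size l + size r /2⌋ × size r ≡ ⌈ size l + size r /2⌉)
           ⊎ (size l ≡ ⌈ size l + size r /2⌉ × size r ≡ ⌊ size l + size r /2⌋)) →
         IsPairwise l → IsPairwise r → IsPairwise (node l r)

data SwapStep {A : Set} : Tree A → Tree A → Set where
  here  : ∀ l r → SwapStep (node l r) (node r l)
  left  : ∀ {l l′} r → SwapStep l l′ → SwapStep (node l r) (node l′ r)
  right : ∀ l {r r′} → SwapStep r r′ → SwapStep (node l r) (node l r′)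

CompEquiv : ∀ {A} → Tree A → Tree A → Set
CompEquiv = Star SwapStep

PairwiseSummation : ℕ → Set
PairwiseSummation n = Σ (Tree (Fin n)) (λ t → IsSummation n t × IsPairwise t)

-- "There are exactly k computationally inequivalent pairwise summations on n
-- variables": a family of k pairwise summations which are pairwise
-- inequivalent and represent every equivalence class.
NumInequivalentPairwise : ℕ → ℕ → Set
NumInequivalentPairwise n k =
  Σ (Fin k → PairwiseSummation n) λ rep →
    (∀ i j → CompEquiv (proj₁ (rep i)) (proj₁ (rep j)) → i ≡ j)
    × (∀ (s : PairwiseSummation n) → ∃ λ i → CompEquiv (proj₁ s) (proj₁ (rep i)))

-- Swapping children generates exactly the isomorphism _≅_ of unordered labelled trees, and
-- unlike a sequence of swaps, an isomorphism can be analysed at the root: node l r ≅ node l′ r′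
-- iff the children match straight or crossed. Hence the classes of pairwise summations on a
-- list xs of k distinct labels are listed without repetition by choosing, at the root, one
-- representative of every unordered split of xs into halves of sizes ⌊k/2⌋ and ⌈k/2⌉, and
-- recursing into both halves. Of the (k choose ⌊k/2⌋) ordered such splits, every unordered one
-- arises twice when k is even and once when k is odd, so the number σ(k) of classes satisfies
-- σ(k)·[2 if k even] = (k choose ⌊k/2⌋)·σ(⌊k/2⌋)·σ(⌈k/2⌉). The recursion for ε is exactly
-- what turns this into σ(k)·2^ε(k) = k!.

module Submission where

open import Defs
open import Data.Fin using (Fin; zero; suc)
open import Data.List using (List; []; _∷_; _++_; length; map; concatMap; cartesianProductWith; allFin; lookup)
open import Data.List.Properties using (length-++; length-map; length-tabulate)
open import Data.List.Membership.Propositional using (_∈_; find; lose)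
open import Data.List.Membership.Propositional.Properties
  using (∈-map⁺; ∈-map⁻; ∈-++⁺ˡ; ∈-++⁺ʳ; ∈-++⁻; ∈-∃++; ∈-concatMap⁺; ∈-concatMap⁻;
         ∈-cartesianProductWith⁺; ∈-cartesianProductWith⁻; ∈-lookup)
open import Data.List.Relation.Unary.Any using (here; there; index)
open import Data.List.Relation.Unary.Any.Properties using (lookup-index)
open import Data.List.Relation.Unary.All as All using (All; [])
import Data.List.Relation.Unary.All.Properties as All
open import Data.List.Relation.Unary.AllPairs as AllPairs using (AllPairs; []; _∷_)
import Data.List.Relation.Unary.AllPairs.Properties as AllPairs
open import Data.List.Relation.Unary.Unique.Propositional using (Unique)
open import Data.List.Relation.Unary.Unique.Propositional.Properties using (Unique[x∷xs]⇒x∉xs; allFin⁺)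
open import Data.List.Relation.Binary.Permutation.Propositional
  using (_↭_; ↭-refl; ↭-sym; ↭-trans; ↭-prep; ↭⇒↭ₛ)
open import Data.List.Relation.Binary.Permutation.Propositional.Properties
  using (↭-length; ↭-empty-inv; ↭-singleton-inv; ∈-resp-↭; ++⁺; ++⁺ˡ; ++⁺ʳ; ++-comm; shift; drop-∷)
import Data.List.Relation.Binary.Permutation.Setoid.Properties as Permutationₛ
open import Data.Nat using (ℕ; zero; suc; _+_; _*_; _^_; _∸_; _/_; _!; _≤_; _<_; _≟_; ⌊_/2⌋; ⌈_/2⌉; s≤s; s≤s⁻¹; z≤n)
open import Data.Nat.Combinatorics using (_C_; nCk+nC[k+1]≡[n+1]C[k+1]; nCk≡nC[n∸k]; nCk≡n!/k![n-k]!; k![n∸k]!∣n!)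
open import Data.Nat.DivMod using (m/n*n≡m; m*n/n≡m)
open import Data.Nat.Properties
  using (suc-injective; +-cancelˡ-≡; +-identityʳ; +-comm; +-suc; +-mono-≤; *-identityˡ; *-identityʳ; *-suc;
         *-distribʳ-+; ^-distribˡ-+-*; m+n∸m≡n; m<m+n; m<n+m; <-≤-trans; ≤-reflexive; m^n≢0; _!*_!≢0;
         ⌊n/2⌋+⌈n/2⌉≡n; ⌊n/2⌋≤n; ⌊n/2⌋-mono; ⌊n/2⌋<n; ⌈n/2⌉<n; *-commutativeSemigroup)
open import Algebra.Properties.CommutativeSemigroup *-commutativeSemigroup using (interchange; x∙yz≈xz∙y; xy∙z≈xz∙y)
open import Data.Product using (∃; ∃₂; _×_; _,_; proj₁; proj₂; map₁; map₂; swap)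
open import Data.Sum as Sum using (_⊎_; inj₁; inj₂)
open import Function using (_∘_; _on_)
open import Level using (0ℓ)
open import Relation.Binary.Core using (Rel)
open import Relation.Binary.PropositionalEquality using (_≡_; refl; cong; cong₂; trans; sym; subst; setoid)
open import Relation.Binary.Construct.Closure.ReflexiveTransitive using (_◅◅_; gmap; fold; return) renaming (ε to ⟨⟩)
open import Relation.Nullary using (¬_; Dec; yes; no; contradiction)
open Relation.Binary.PropositionalEquality.≡-Reasoning

infix 4 _≅_ _≇_

data _≅_ {A : Set} : Tree A → Tree A → Set where
  leaf     : ∀ a → leaf a ≅ leaf a
  straight : ∀ {l r l′ r′} → l ≅ l′ → r ≅ r′ → node l r ≅ node l′ r′
  crossed  : ∀ {l r l′ r′} → l ≅ r′ → r ≅ l′ → node l r ≅ node l′ r′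

_≇_ : ∀ {A} → Tree A → Tree A → Set
t ≇ u = ¬ (t ≅ u)

module _ {A : Set} where

  ≅-refl : ∀ {t : Tree A} → t ≅ t
  ≅-refl {leaf a}   = leaf a
  ≅-refl {node l r} = straight ≅-refl ≅-refl

  ≅-sym : ∀ {t u : Tree A} → t ≅ u → u ≅ t
  ≅-sym (leaf a)       = leaf a
  ≅-sym (straight p q) = straight (≅-sym p) (≅-sym q)
  ≅-sym (crossed p q)  = crossed (≅-sym q) (≅-sym p)

  ≅-trans : ∀ {t u v : Tree A} → t ≅ u → u ≅ v → t ≅ v
  ≅-trans (leaf a)       (leaf .a)        = leaf a
  ≅-trans (straight p q) (straight p′ q′) = straight (≅-trans p p′) (≅-trans q q′)
  ≅-trans (straight p q) (crossed p′ q′)  = crossed (≅-trans p p′) (≅-trans q q′)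
  ≅-trans (crossed p q)  (straight p′ q′) = crossed (≅-trans p q′) (≅-trans q p′)
  ≅-trans (crossed p q)  (crossed p′ q′)  = straight (≅-trans p q′) (≅-trans q p′)

  SwapStep⇒≅ : ∀ {t u : Tree A} → SwapStep t u → t ≅ u
  SwapStep⇒≅ (here l r)  = crossed ≅-refl ≅-refl
  SwapStep⇒≅ (left r s)  = straight (SwapStep⇒≅ s) ≅-refl
  SwapStep⇒≅ (right l s) = straight ≅-refl (SwapStep⇒≅ s)

  CompEquiv⇒≅ : ∀ {t u : Tree A} → CompEquiv t u → t ≅ u
  CompEquiv⇒≅ = fold _≅_ (λ s p → ≅-trans (SwapStep⇒≅ s) p) ≅-refl

  CompEquiv-node : ∀ {l r l′ r′ : Tree A} → CompEquiv l l′ → CompEquiv r r′ → CompEquiv (node l r) (node l′ r′)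
  CompEquiv-node {r = r} {l′} p q = gmap (λ x → node x r) (left r) p ◅◅ gmap (node l′) (right l′) q

  ≅⇒CompEquiv : ∀ {t u : Tree A} → t ≅ u → CompEquiv t u
  ≅⇒CompEquiv (leaf a)       = ⟨⟩
  ≅⇒CompEquiv (straight p q) = CompEquiv-node (≅⇒CompEquiv p) (≅⇒CompEquiv q)
  ≅⇒CompEquiv (crossed {l′ = l′} {r′ = r′} p q) =
    CompEquiv-node (≅⇒CompEquiv p) (≅⇒CompEquiv q) ◅◅ return (here r′ l′)

  ≅⇒leaves↭ : ∀ {t u : Tree A} → t ≅ u → leaves t ↭ leaves u
  ≅⇒leaves↭ (leaf a)                   = ↭-refl
  ≅⇒leaves↭ (straight p q)             = ++⁺ (≅⇒leaves↭ p) (≅⇒leaves↭ q)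
  ≅⇒leaves↭ (crossed {r = r} {l′ = l′} p q) =
    ↭-trans (++-comm _ (leaves r)) (++⁺ (≅⇒leaves↭ q) (≅⇒leaves↭ p))

module _ {A : Set} where

  AllPairs-mapWith∈ : ∀ {R S : Rel A 0ℓ} {xs} → (∀ {a b} → a ∈ xs → b ∈ xs → R a b → S a b) →
                      AllPairs R xs → AllPairs S xs
  AllPairs-mapWith∈ f []         = []
  AllPairs-mapWith∈ f (Rx ∷ Rxs) =
    All.tabulate (λ b∈ → f (here refl) (there b∈) (All.lookup Rx b∈)) ∷
    AllPairs-mapWith∈ (λ a∈ b∈ → f (there a∈) (there b∈)) Rxs

  AllPairs-++⁻ : ∀ {R : Rel A 0ℓ} xs {ys} → AllPairs R (xs ++ ys) → AllPairs R xs × AllPairs R ys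
  AllPairs-++⁻ []       Rys         = [] , Rys
  AllPairs-++⁻ (x ∷ xs) (Rx ∷ Rxys) with Rxs , Rys ← AllPairs-++⁻ xs Rxys = All.++⁻ˡ xs Rx ∷ Rxs , Rys

  Unique-parts : ∀ {P Q xs : List A} → P ++ Q ↭ xs → Unique xs → Unique P × Unique Q
  Unique-parts {P} p xs! = AllPairs-++⁻ P (Permutationₛ.Unique-resp-↭ (setoid A) (↭⇒↭ₛ (↭-sym p)) xs!)

  ∈⇒↭∷ : ∀ {x : A} {xs} → x ∈ xs → ∃ λ ys → xs ↭ x ∷ ys
  ∈⇒↭∷ {x} x∈xs with ys , zs , refl ← ∈-∃++ x∈xs = ys ++ zs , shift x ys zs

module _ {A B C : Set} where

  length-cartesianProductWith : ∀ (f : A → B → C) xs ys →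
                                length (cartesianProductWith f xs ys) ≡ length xs * length ys
  length-cartesianProductWith f []       ys = refl
  length-cartesianProductWith f (x ∷ xs) ys =
    trans (length-++ (map (f x) ys))
          (cong₂ _+_ (length-map (f x) ys) (length-cartesianProductWith f xs ys))

module _ {A B : Set} where

  length-concatMap-weighted : ∀ (g : A → List B) {w c} xs →
                              (∀ {x} → x ∈ xs → length (g x) * w ≡ c) →
                              length (concatMap g xs) * w ≡ length xs * c
  length-concatMap-weighted g         []       _    = refl
  length-concatMap-weighted g {w} {c} (x ∷ xs) gx≡c = begin
    length (g x ++ concatMap g xs) * w            ≡⟨ cong (_* w) (length-++ (g x)) ⟩
    (length (g x) + length (concatMap g xs)) * w  ≡⟨ *-distribʳ-+ w (length (g x)) _ ⟩
    length (g x) * w + length (concatMap g xs) * w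
      ≡⟨ cong₂ _+_ (gx≡c (here refl)) (length-concatMap-weighted g xs (λ x∈ → gx≡c (there x∈))) ⟩
    c + length xs * c                             ∎

⌊/2⌋-complement : ∀ {a b k} → a + b ≡ k → a ≡ ⌊ k /2⌋ → b ≡ ⌈ k /2⌉
⌊/2⌋-complement {a} {b} {k} a+b≡k refl = +-cancelˡ-≡ ⌊ k /2⌋ b ⌈ k /2⌉ (trans a+b≡k (sym (⌊n/2⌋+⌈n/2⌉≡n k)))

n∸⌊n/2⌋≡⌈n/2⌉ : ∀ n → n ∸ ⌊ n /2⌋ ≡ ⌈ n /2⌉
n∸⌊n/2⌋≡⌈n/2⌉ n = trans (cong (_∸ ⌊ n /2⌋) (sym (⌊n/2⌋+⌈n/2⌉≡n n))) (m+n∸m≡n ⌊ n /2⌋ ⌈ n /2⌉)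

Balanced : ℕ → Set
Balanced k = ⌊ k /2⌋ ≡ ⌈ k /2⌉

balanced? : ∀ k → Dec (Balanced k)
balanced? k = ⌊ k /2⌋ ≟ ⌈ k /2⌉

-- The number of ways to order an unordered split of a k-element list into halves.
orderings : ℕ → ℕ
orderings k with balanced? k
... | yes _ = 2
... | no  _ = 1

nCk*[k!*[n∸k]!]≡n! : ∀ {n k} → k ≤ n → (n C k) * (k ! * (n ∸ k) !) ≡ n !
nCk*[k!*[n∸k]!]≡n! {n} {k} k≤n =
  trans (cong (_* (k ! * (n ∸ k) !)) (nCk≡n!/k![n-k]! k≤n)) (m/n*n≡m {{k !* (n ∸ k) !≢0}} (k![n∸k]!∣n! k≤n))

central-binomial : ∀ k → (k C ⌊ k /2⌋) * (⌊ k /2⌋ ! * ⌈ k /2⌉ !) ≡ k !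
central-binomial k = subst (λ b → (k C ⌊ k /2⌋) * (⌊ k /2⌋ ! * b !) ≡ k !) (n∸⌊n/2⌋≡⌈n/2⌉ k) (nCk*[k!*[n∸k]!]≡n! (⌊n/2⌋≤n k))

⌈n/2⌉≡1+⌊n/2⌋ : ∀ n → ¬ Balanced n → ⌈ n /2⌉ ≡ suc ⌊ n /2⌋
⌈n/2⌉≡1+⌊n/2⌋ zero          unbalanced = contradiction refl unbalanced
⌈n/2⌉≡1+⌊n/2⌋ (suc zero)    _          = refl
⌈n/2⌉≡1+⌊n/2⌋ (suc (suc n)) unbalanced = cong suc (⌈n/2⌉≡1+⌊n/2⌋ n (unbalanced ∘ cong suc))

ε-halving : ∀ (ε : ℕ → ℕ) →
            (∀ m → 1 ≤ m → ε (2 * m) ≡ 2 * ε m + 1) →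
            (∀ m → 1 ≤ m → ε (2 * m + 1) ≡ ε m + ε (m + 1)) →
            ∀ k → 2 ≤ k → 2 ^ ε k ≡ orderings k * 2 ^ (ε ⌊ k /2⌋ + ε ⌈ k /2⌉)
ε-halving ε ε-even ε-odd k 2≤k with balanced? k
... | yes balanced = begin
  2 ^ ε k                   ≡⟨ cong (λ n → 2 ^ ε n) k≡2a ⟩
  2 ^ ε (2 * a)             ≡⟨ cong (2 ^_) (ε-even a (⌊n/2⌋-mono 2≤k)) ⟩
  2 ^ (2 * ε a + 1)         ≡⟨ cong (2 ^_) (+-comm (2 * ε a) 1) ⟩
  2 * 2 ^ (2 * ε a)         ≡⟨ cong (λ e → 2 * 2 ^ e) 2εa≡εa+εb ⟩
  2 * 2 ^ (ε a + ε ⌈ k /2⌉) ∎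
  where
  a = ⌊ k /2⌋
  k≡2a : k ≡ 2 * a
  k≡2a = trans (sym (⌊n/2⌋+⌈n/2⌉≡n k)) (trans (cong (a +_) (sym balanced)) (cong (a +_) (sym (+-identityʳ a))))
  2εa≡εa+εb : 2 * ε a ≡ ε a + ε ⌈ k /2⌉
  2εa≡εa+εb = trans (cong (ε a +_) (+-identityʳ (ε a))) (cong (λ n → ε a + ε n) balanced)
... | no unbalanced = begin
  2 ^ ε k                   ≡⟨ cong (λ n → 2 ^ ε n) k≡2a+1 ⟩
  2 ^ ε (2 * a + 1)         ≡⟨ cong (2 ^_) (ε-odd a (⌊n/2⌋-mono 2≤k)) ⟩
  2 ^ (ε a + ε (a + 1))     ≡⟨ cong (λ n → 2 ^ (ε a + ε n)) (trans (+-comm a 1) (sym b≡1+a)) ⟩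
  2 ^ (ε a + ε ⌈ k /2⌉)     ≡⟨ *-identityˡ _ ⟨
  1 * 2 ^ (ε a + ε ⌈ k /2⌉) ∎
  where
  a = ⌊ k /2⌋
  b≡1+a : ⌈ k /2⌉ ≡ suc a
  b≡1+a = ⌈n/2⌉≡1+⌊n/2⌋ k unbalanced
  k≡2a+1 : k ≡ 2 * a + 1
  k≡2a+1 = begin
    k               ≡⟨ ⌊n/2⌋+⌈n/2⌉≡n k ⟨
    a + ⌈ k /2⌉     ≡⟨ cong (a +_) b≡1+a ⟩
    a + suc a       ≡⟨ +-suc a a ⟩
    suc (a + a)     ≡⟨ cong (λ n → suc (a + n)) (+-identityʳ a) ⟨
    suc (2 * a)     ≡⟨ +-comm 1 (2 * a) ⟩
    2 * a + 1       ∎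

module _ {A : Set} where

  infix 4 _↮_

  _↮_ : List A → List A → Set
  P ↮ Q = ¬ (P ↭ Q)

  choose : ℕ → List A → List (List A × List A)
  choose zero    xs       = ([] , xs) ∷ []
  choose (suc k) []       = []
  choose (suc k) (x ∷ xs) = map (map₁ (x ∷_)) (choose k xs) ++ map (map₂ (x ∷_)) (choose (suc k) xs)

  choose-length : ∀ k xs → length (choose k xs) ≡ length xs C k
  choose-length zero    xs       = refl
  choose-length (suc k) []       = refl
  choose-length (suc k) (x ∷ xs) = begin
    length (map (map₁ (x ∷_)) (choose k xs) ++ map (map₂ (x ∷_)) (choose (suc k) xs))
      ≡⟨ length-++ (map (map₁ (x ∷_)) (choose k xs)) ⟩
    length (map (map₁ (x ∷_)) (choose k xs)) + length (map (map₂ (x ∷_)) (choose (suc k) xs))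
      ≡⟨ cong₂ _+_ (length-map _ (choose k xs)) (length-map _ (choose (suc k) xs)) ⟩
    length (choose k xs) + length (choose (suc k) xs)
      ≡⟨ cong₂ _+_ (choose-length k xs) (choose-length (suc k) xs) ⟩
    length xs C k + length xs C suc k
      ≡⟨ nCk+nC[k+1]≡[n+1]C[k+1] (length xs) k ⟩
    suc (length xs) C suc k ∎

  choose-sound : ∀ k xs {P Q} → (P , Q) ∈ choose k xs → P ++ Q ↭ xs × length P ≡ k
  choose-sound zero    xs       (here refl) = ↭-refl , refl
  choose-sound (suc k) (x ∷ xs) PQ∈ with ∈-++⁻ (map (map₁ (x ∷_)) (choose k xs)) PQ∈
  ... | inj₁ ∈left with (P , Q) , PQ∈′ , refl ← ∈-map⁻ _ ∈left
    with p , len ← choose-sound k xs PQ∈′ = ↭-prep x p , cong suc len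
  ... | inj₂ ∈right with (P , Q) , PQ∈′ , refl ← ∈-map⁻ _ ∈right
    with p , len ← choose-sound (suc k) xs PQ∈′ = ↭-trans (shift x P Q) (↭-prep x p) , len

  choose-complete : ∀ k {xs P Q} → P ++ Q ↭ xs → length P ≡ k →
                    ∃₂ λ P′ Q′ → (P′ , Q′) ∈ choose k xs × P ↭ P′ × Q ↭ Q′

  choose-complete-∈ : ∀ k {x xs P Q} → P ++ Q ↭ x ∷ xs → x ∈ P → length P ≡ suc k →
                      ∃₂ λ P′ Q′ → (P′ , Q′) ∈ choose k xs × P ↭ x ∷ P′ × Q ↭ Q′
  choose-complete-∈ k {x} {P = P} {Q} p x∈P len with R , P↭xR ← ∈⇒↭∷ x∈P
    with P′ , Q′ , PQ∈ , R↭P′ , Q↭Q′ ← choose-complete k (drop-∷ (↭-trans (↭-sym (++⁺ʳ Q P↭xR)) p))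
                                          (suc-injective (trans (sym (↭-length P↭xR)) len))
    = P′ , Q′ , PQ∈ , ↭-trans P↭xR (↭-prep x R↭P′) , Q↭Q′

  choose-complete zero {xs} {[]} p refl = [] , xs , here refl , ↭-refl , p
  choose-complete (suc k) {[]} {_ ∷ _} p _ with () ← ↭-empty-inv p
  choose-complete (suc k) {x ∷ xs} {P} {Q} p len with ∈-++⁻ P (∈-resp-↭ (↭-sym p) (here refl))
  ... | inj₁ x∈P with P′ , Q′ , PQ∈ , P↭xP′ , Q↭Q′ ← choose-complete-∈ k p x∈P len
    = x ∷ P′ , Q′ , ∈-++⁺ˡ (∈-map⁺ (map₁ (x ∷_)) PQ∈) , P↭xP′ , Q↭Q′
  ... | inj₂ x∈Q with R , Q↭xR ← ∈⇒↭∷ x∈Q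
    with P′ , Q′ , PQ∈ , P↭P′ , R↭Q′ ← choose-complete (suc k)
           (drop-∷ (↭-trans (↭-sym (shift x P R)) (↭-trans (++⁺ˡ P (↭-sym Q↭xR)) p))) len
    = P′ , x ∷ Q′ , ∈-++⁺ʳ _ (∈-map⁺ (map₂ (x ∷_)) PQ∈) , P↭P′ , ↭-trans Q↭xR (↭-prep x R↭Q′)

  choose-distinct : ∀ k {xs} → Unique xs → AllPairs (_↮_ on proj₁) (choose k xs)
  choose-distinct zero    _                  = [] ∷ []
  choose-distinct (suc k) {[]}     _         = []
  choose-distinct (suc k) {x ∷ xs} (x∉ ∷ xs!) = AllPairs.++⁺
    (AllPairs.map⁺ (AllPairs.map (λ P↮P′ p → P↮P′ (drop-∷ p)) (choose-distinct k xs!)))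
    (AllPairs.map⁺ (choose-distinct (suc k) xs!))
    (All.map⁺ (All.tabulate λ ∈left → All.map⁺ (All.tabulate λ ∈right → left↮right ∈left ∈right)))
    where
    left↮right : ∀ {s s′} → s ∈ choose k xs → s′ ∈ choose (suc k) xs → x ∷ proj₁ s ↮ proj₁ s′
    left↮right _ s′∈ p = Unique[x∷xs]⇒x∉xs (x∉ ∷ xs!)
      (∈-resp-↭ (proj₁ (choose-sound (suc k) xs s′∈)) (∈-++⁺ˡ (∈-resp-↭ p (here refl))))

module _ {A : Set} where

  split-length : ∀ {P Q xs : List A} → P ++ Q ↭ xs → length P ≡ ⌊ length xs /2⌋ →
                 length Q ≡ ⌈ length xs /2⌉
  split-length {P} p = ⌊/2⌋-complement (trans (sym (length-++ P)) (↭-length p))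

  -- One representative of each unordered split into halves: when both halves have the same
  -- size, the one containing the head comes first.
  halves : List A → List (List A × List A)
  halves []       = []
  halves (x ∷ xs) with balanced? (suc (length xs))
  ... | yes _ = map (map₁ (x ∷_)) (choose ⌊ length xs /2⌋ xs)
  ... | no  _ = choose ⌊ suc (length xs) /2⌋ (x ∷ xs)

  halves-sound : ∀ x xs {P Q} → (P , Q) ∈ halves (x ∷ xs) →
                 P ++ Q ↭ x ∷ xs × length P ≡ ⌊ suc (length xs) /2⌋
  halves-sound x xs PQ∈ with balanced? (suc (length xs))
  ... | no  _ = choose-sound ⌊ suc (length xs) /2⌋ (x ∷ xs) PQ∈
  ... | yes balanced with (P , Q) , PQ∈′ , refl ← ∈-map⁻ _ PQ∈
    with p , len ← choose-sound ⌊ length xs /2⌋ xs PQ∈′ = ↭-prep x p , trans (cong suc len) (sym balanced)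

  halves-count : ∀ x xs → length (halves (x ∷ xs)) * orderings (suc (length xs)) ≡
                          suc (length xs) C ⌊ suc (length xs) /2⌋
  halves-count x xs with balanced? (suc (length xs))
  ... | no  _ = trans (*-identityʳ _) (choose-length ⌊ suc (length xs) /2⌋ (x ∷ xs))
  ... | yes balanced = begin
    length (map (map₁ (x ∷_)) (choose m xs)) * 2 ≡⟨ cong (_* 2) (length-map _ (choose m xs)) ⟩
    length (choose m xs) * 2                    ≡⟨ cong (_* 2) (choose-length m xs) ⟩
    (n C m) * 2                                 ≡⟨ *-suc (n C m) 1 ⟩
    n C m + (n C m) * 1                         ≡⟨ cong (n C m +_) (*-identityʳ (n C m)) ⟩
    n C m + n C m                               ≡⟨ cong (n C m +_) symmetric ⟩
    n C m + n C suc m                           ≡⟨ nCk+nC[k+1]≡[n+1]C[k+1] n m ⟩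
    suc n C suc m                               ≡⟨ cong (suc n C_) balanced ⟨
    suc n C ⌊ suc n /2⌋                         ∎
    where
    n = length xs
    m = ⌊ n /2⌋
    symmetric : n C m ≡ n C suc m
    symmetric = trans (nCk≡nC[n∸k] (⌊n/2⌋≤n n)) (cong (n C_) (trans (n∸⌊n/2⌋≡⌈n/2⌉ n) balanced))

  halves-distinct : ∀ x xs → Unique (x ∷ xs) → AllPairs (_↮_ on proj₁) (halves (x ∷ xs))
  halves-distinct x xs xs! with balanced? (suc (length xs))
  ... | no  _ = choose-distinct ⌊ suc (length xs) /2⌋ xs!
  ... | yes _ = AllPairs.map⁺ (AllPairs.map (λ P↮P′ p → P↮P′ (drop-∷ p))
                                            (choose-distinct ⌊ length xs /2⌋ (AllPairs.tail xs!)))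

  halves-apart : ∀ x xs → Unique (x ∷ xs) → ∀ {P Q P′ Q′} →
                 (P , Q) ∈ halves (x ∷ xs) → (P′ , Q′) ∈ halves (x ∷ xs) → P ↮ Q′
  halves-apart x xs xs! {P′ = P′} {Q′} PQ∈ PQ∈′ P↭Q′ with balanced? (suc (length xs))
  ... | no unbalanced
    with _ , lenP ← choose-sound ⌊ suc (length xs) /2⌋ (x ∷ xs) PQ∈
       | p′ , lenP′ ← choose-sound ⌊ suc (length xs) /2⌋ (x ∷ xs) PQ∈′
    = unbalanced (trans (sym lenP) (trans (↭-length P↭Q′) (split-length {P′} {Q′} p′ lenP′)))
  ... | yes _
    with _ , _ , refl ← ∈-map⁻ _ PQ∈
       | (P₀′ , _) , PQ∈₀′ , refl ← ∈-map⁻ _ PQ∈′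
    = Unique[x∷xs]⇒x∉xs xs!
        (∈-resp-↭ (proj₁ (choose-sound ⌊ length xs /2⌋ xs PQ∈₀′)) (∈-++⁺ʳ P₀′ (∈-resp-↭ P↭Q′ (here refl))))

  infix 4 _↭ᵘ_

  _↭ᵘ_ : List A × List A → List A × List A → Set
  (P , Q) ↭ᵘ (P′ , Q′) = (P ↭ P′ × Q ↭ Q′) ⊎ (Q ↭ P′ × P ↭ Q′)

  halves-complete-ordered : ∀ x xs {P Q} → P ++ Q ↭ x ∷ xs → length P ≡ ⌊ suc (length xs) /2⌋ →
                            ∃₂ λ P′ Q′ → (P′ , Q′) ∈ halves (x ∷ xs) × (P , Q) ↭ᵘ (P′ , Q′)
  halves-complete-ordered x xs {P} {Q} p len with balanced? (suc (length xs))
  ... | no _ with P′ , Q′ , PQ∈ , P↭P′ , Q↭Q′ ← choose-complete ⌊ suc (length xs) /2⌋ p len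
    = P′ , Q′ , PQ∈ , inj₁ (P↭P′ , Q↭Q′)
  ... | yes balanced with ∈-++⁻ P (∈-resp-↭ (↭-sym p) (here refl))
  ...   | inj₁ x∈P with P′ , Q′ , PQ∈ , P↭xP′ , Q↭Q′ ← choose-complete-∈ ⌊ length xs /2⌋ p x∈P (trans len balanced)
    = x ∷ P′ , Q′ , ∈-map⁺ (map₁ (x ∷_)) PQ∈ , inj₁ (P↭xP′ , Q↭Q′)
  ...   | inj₂ x∈Q with P′ , Q′ , PQ∈ , Q↭xP′ , P↭Q′ ←
                          choose-complete-∈ ⌊ length xs /2⌋ (↭-trans (++-comm Q P) p) x∈Q (split-length {P} {Q} p len)
    = x ∷ P′ , Q′ , ∈-map⁺ (map₁ (x ∷_)) PQ∈ , inj₂ (Q↭xP′ , P↭Q′)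

  halves-complete : ∀ x xs {P Q} → P ++ Q ↭ x ∷ xs →
                    length P ≡ ⌊ suc (length xs) /2⌋ ⊎ length Q ≡ ⌊ suc (length xs) /2⌋ →
                    ∃₂ λ P′ Q′ → (P′ , Q′) ∈ halves (x ∷ xs) × (P , Q) ↭ᵘ (P′ , Q′)
  halves-complete x xs p (inj₁ lenP) = halves-complete-ordered x xs p lenP
  halves-complete x xs {P} {Q} p (inj₂ lenQ)
    with P′ , Q′ , PQ∈ , QP↭ᵘ ← halves-complete-ordered x xs (↭-trans (++-comm Q P) p) lenQ
    = P′ , Q′ , PQ∈ , Sum.swap QP↭ᵘ

module _ {A : Set} where

  size≡length-leaves : (t : Tree A) → size t ≡ length (leaves t)
  size≡length-leaves (leaf _)   = refl
  size≡length-leaves (node l r) = trans (cong (_+ size r) (size≡length-leaves l))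
                                        (trans (cong (length (leaves l) +_) (size≡length-leaves r))
                                               (sym (length-++ (leaves l))))

  size-↭ : ∀ (t : Tree A) {xs} → leaves t ↭ xs → size t ≡ length xs
  size-↭ t p = trans (size≡length-leaves t) (↭-length p)

  1≤size : ∀ (t : Tree A) → 1 ≤ size t
  1≤size (leaf _)   = s≤s z≤n
  1≤size (node l r) = +-mono-≤ {0} z≤n (1≤size r)

  2≤size-node : ∀ (l r : Tree A) → 2 ≤ size (node l r)
  2≤size-node l r = +-mono-≤ (1≤size l) (1≤size r)

  IsPairwise-node : ∀ {l r : Tree A} → size l ≡ ⌊ size l + size r /2⌋ →
                    IsPairwise l → IsPairwise r → IsPairwise (node l r)
  IsPairwise-node lhalf = node (inj₁ (lhalf , ⌊/2⌋-complement refl lhalf))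

  joins : (List A → List (Tree A)) → List A × List A → List (Tree A)
  joins g (P , Q) = cartesianProductWith node (g P) (g Q)

  ∈-joins⁻ : ∀ g H {t} → t ∈ concatMap (joins g) H →
             ∃₂ λ P Q → (P , Q) ∈ H × ∃₂ λ l r → l ∈ g P × r ∈ g Q × t ≡ node l r
  ∈-joins⁻ g H t∈ with (P , Q) , PQ∈ , t∈′ ← find (∈-concatMap⁻ (joins g) {xs = H} t∈) =
    P , Q , PQ∈ , ∈-cartesianProductWith⁻ node (g P) (g Q) t∈′

  ∈-joins⁺ : ∀ g {H P Q l r} → (P , Q) ∈ H → l ∈ g P → r ∈ g Q → node l r ∈ concatMap (joins g) H
  ∈-joins⁺ g PQ∈ l∈ r∈ = ∈-concatMap⁺ (joins g) (lose PQ∈ (∈-cartesianProductWith⁺ node l∈ r∈))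

  -- The first argument is fuel: pairwise f xs is the intended list once length xs < f.
  pairwise : ℕ → List A → List (Tree A)
  pairwise zero    _              = []
  pairwise (suc f) []             = []
  pairwise (suc f) (x ∷ [])       = leaf x ∷ []
  pairwise (suc f) xs@(_ ∷ _ ∷ _) = concatMap (joins (pairwise f)) (halves xs)

  pairwise-sound : ∀ f xs {t} → t ∈ pairwise f xs → IsPairwise t × leaves t ↭ xs
  pairwise-sound (suc f) (x ∷ [])     (here refl) = leaf x , ↭-refl
  pairwise-sound (suc f) (x ∷ y ∷ ys) t∈
    with P , Q , PQ∈ , l , r , l∈ , r∈ , refl ← ∈-joins⁻ (pairwise f) (halves (x ∷ y ∷ ys)) t∈
    with p , lenP ← halves-sound x (y ∷ ys) PQ∈
    with pw-l , l↭P ← pairwise-sound f P l∈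
    with pw-r , r↭Q ← pairwise-sound f Q r∈
    = IsPairwise-node lhalf pw-l pw-r , lr↭xs
    where
    lr↭xs : leaves l ++ leaves r ↭ x ∷ y ∷ ys
    lr↭xs = ↭-trans (++⁺ l↭P r↭Q) p
    lhalf : size l ≡ ⌊ size l + size r /2⌋
    lhalf = trans (size-↭ l l↭P) (trans lenP (cong ⌊_/2⌋ (sym (size-↭ (node l r) lr↭xs))))

  pairwise-complete : ∀ f {t} → IsPairwise t → ∀ {xs} → leaves t ↭ xs → length xs < f →
                      ∃ λ u → u ∈ pairwise f xs × t ≅ u
  pairwise-complete (suc f) (leaf a) p _ with refl ← ↭-singleton-inv (↭-sym p) = leaf a , here refl , leaf a
  pairwise-complete (suc f) (node {l} {r} _ _ _) {[]} p _ =
    contradiction (subst (2 ≤_) (size-↭ (node l r) p) (2≤size-node l r)) λ ()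
  pairwise-complete (suc f) (node {l} {r} _ _ _) {_ ∷ []} p _ =
    contradiction (subst (2 ≤_) (size-↭ (node l r) p) (2≤size-node l r)) λ { (s≤s ()) }
  pairwise-complete (suc f) (node {l} {r} halfsizes pw-l pw-r) {x ∷ y ∷ ys} p k<f =
    complete-from (halves-complete x (y ∷ ys) p (Sum.map (toLength l ∘ proj₁) (toLength r ∘ proj₂) halfsizes))
    where
    toLength : ∀ t → size t ≡ ⌊ size (node l r) /2⌋ → length (leaves t) ≡ ⌊ length (x ∷ y ∷ ys) /2⌋
    toLength t half = trans (sym (size≡length-leaves t)) (trans half (cong ⌊_/2⌋ (size-↭ (node l r) p)))

    bound : ∀ t {P} → leaves t ↭ P → size t < size (node l r) → length P < f
    bound t t↭P t<lr =
      subst (_< f) (size-↭ t t↭P) (<-≤-trans t<lr (subst (_≤ f) (sym (size-↭ (node l r) p)) (s≤s⁻¹ k<f)))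

    l<lr : size l < size (node l r)
    l<lr = m<m+n (size l) (1≤size r)

    r<lr : size r < size (node l r)
    r<lr = m<n+m (size r) (1≤size l)

    complete-from : (∃₂ λ P Q → (P , Q) ∈ halves (x ∷ y ∷ ys) × (leaves l , leaves r) ↭ᵘ (P , Q)) →
                    ∃ λ u → u ∈ pairwise (suc f) (x ∷ y ∷ ys) × node l r ≅ u
    complete-from (P , Q , PQ∈ , inj₁ (l↭P , r↭Q))
      with l′ , l′∈ , l≅l′ ← pairwise-complete f pw-l l↭P (bound l l↭P l<lr)
         | r′ , r′∈ , r≅r′ ← pairwise-complete f pw-r r↭Q (bound r r↭Q r<lr)
      = node l′ r′ , ∈-joins⁺ (pairwise f) PQ∈ l′∈ r′∈ , straight l≅l′ r≅r′
    complete-from (P , Q , PQ∈ , inj₂ (r↭P , l↭Q))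
      with r′ , r′∈ , r≅r′ ← pairwise-complete f pw-r r↭P (bound r r↭P r<lr)
         | l′ , l′∈ , l≅l′ ← pairwise-complete f pw-l l↭Q (bound l l↭Q l<lr)
      = node r′ l′ , ∈-joins⁺ (pairwise f) PQ∈ r′∈ l′∈ , crossed l≅l′ r≅r′

  node-distinct : ∀ {ls rs : List (Tree A)} → AllPairs _≇_ ls → AllPairs _≇_ rs →
                  (∀ {l r} → l ∈ ls → r ∈ rs → l ≇ r) → AllPairs _≇_ (cartesianProductWith node ls rs)
  node-distinct {[]}     _             _    _       = []
  node-distinct {l ∷ ls} {rs} (l≇ls ∷ ls≇) rs≇ ls≇rs = AllPairs.++⁺
    (AllPairs.map⁺ (AllPairs-mapWith∈ same-left rs≇))
    (node-distinct ls≇ rs≇ (ls≇rs ∘ there))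
    (All.map⁺ (All.tabulate λ r∈ → All.tabulate (different-left r∈)))
    where
    same-left : ∀ {r r′} → r ∈ rs → r′ ∈ rs → r ≇ r′ → node l r ≇ node l r′
    same-left _ _   r≇r′ (straight _ r≅r′) = r≇r′ r≅r′
    same-left _ r′∈ _    (crossed l≅r′ _)  = ls≇rs (here refl) r′∈ l≅r′

    different-left : ∀ {r v} → r ∈ rs → v ∈ cartesianProductWith node ls rs → node l r ≇ v
    different-left r∈ v∈ lr≅v with l′ , r′ , l′∈ , r′∈ , refl ← ∈-cartesianProductWith⁻ node ls rs v∈ with lr≅v
    ... | straight l≅l′ _ = All.lookup l≇ls l′∈ l≅l′
    ... | crossed l≅r′ _  = ls≇rs (here refl) r′∈ l≅r′

  pairwise-distinct : ∀ f {xs} → Unique xs → AllPairs _≇_ (pairwise f xs)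
  pairwise-distinct zero                   _   = []
  pairwise-distinct (suc f) {[]}           _   = []
  pairwise-distinct (suc f) {_ ∷ []}       _   = [] ∷ []
  pairwise-distinct (suc f) {x ∷ y ∷ ys} xs! = AllPairs.concat⁺
    (All.map⁺ (All.tabulate block-distinct))
    (AllPairs.map⁺ (AllPairs-mapWith∈ blocks-apart (halves-distinct x (y ∷ ys) xs!)))
    where
    parts-↭ : ∀ {P P′ t t′} → t ∈ pairwise f P → t′ ∈ pairwise f P′ → t ≅ t′ → P ↭ P′
    parts-↭ t∈ t′∈ t≅t′ = ↭-trans (↭-sym (proj₂ (pairwise-sound f _ t∈)))
                                   (↭-trans (≅⇒leaves↭ t≅t′) (proj₂ (pairwise-sound f _ t′∈)))

    block-distinct : ∀ {s} → s ∈ halves (x ∷ y ∷ ys) → AllPairs _≇_ (joins (pairwise f) s)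
    block-distinct {P , Q} PQ∈ with P! , Q! ← Unique-parts (proj₁ (halves-sound x (y ∷ ys) PQ∈)) xs! =
      node-distinct (pairwise-distinct f P!) (pairwise-distinct f Q!)
                    (λ l∈ r∈ l≅r → halves-apart x (y ∷ ys) xs! PQ∈ PQ∈ (parts-↭ l∈ r∈ l≅r))

    blocks-apart : ∀ {s s′} → s ∈ halves (x ∷ y ∷ ys) → s′ ∈ halves (x ∷ y ∷ ys) → proj₁ s ↮ proj₁ s′ →
                   All (λ u → All (u ≇_) (joins (pairwise f) s′)) (joins (pairwise f) s)
    blocks-apart {P , Q} {P′ , Q′} PQ∈ PQ∈′ P↮P′ = All.tabulate λ u∈ → All.tabulate λ v∈ → apart u∈ v∈
      where
      apart : ∀ {u v} → u ∈ joins (pairwise f) (P , Q) → v ∈ joins (pairwise f) (P′ , Q′) → u ≇ v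
      apart u∈ v∈ u≅v
        with _ , _ , l∈ , _ , refl ← ∈-cartesianProductWith⁻ node (pairwise f P) (pairwise f Q) u∈
        with _ , _ , l′∈ , r′∈ , refl ← ∈-cartesianProductWith⁻ node (pairwise f P′) (pairwise f Q′) v∈
        with u≅v
      ... | straight l≅l′ _ = P↮P′ (parts-↭ l∈ l′∈ l≅l′)
      ... | crossed l≅r′ _  = halves-apart x (y ∷ ys) xs! PQ∈ PQ∈′ (parts-↭ l∈ r′∈ l≅r′)

module _ {A : Set} (ε : ℕ → ℕ) (ε-one : ε 1 ≡ 0)
         (ε-halving : ∀ k → 2 ≤ k → 2 ^ ε k ≡ orderings k * 2 ^ (ε ⌊ k /2⌋ + ε ⌈ k /2⌉)) where

  pairwise-count : ∀ f (xs : List A) → length xs < f → 1 ≤ length xs →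
                   length (pairwise f xs) * 2 ^ ε (length xs) ≡ length xs !
  pairwise-count (suc f) (x ∷ [])     _   _ rewrite ε-one = refl
  pairwise-count (suc f) (x ∷ y ∷ ys) k<f _ = begin
    length T * 2 ^ ε k                         ≡⟨ cong (length T *_) (ε-halving k (s≤s (s≤s z≤n))) ⟩
    length T * (orderings k * 2 ^ (ε a + ε b)) ≡⟨ x∙yz≈xz∙y (length T) (orderings k) _ ⟩
    length T * 2 ^ (ε a + ε b) * orderings k   ≡⟨ cong (_* orderings k) (length-concatMap-weighted _ H block-count) ⟩
    length H * (a ! * b !) * orderings k       ≡⟨ xy∙z≈xz∙y (length H) (a ! * b !) (orderings k) ⟩
    length H * orderings k * (a ! * b !)       ≡⟨ cong (_* (a ! * b !)) (halves-count x (y ∷ ys)) ⟩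
    (k C a) * (a ! * b !)                      ≡⟨ central-binomial k ⟩
    k !                                        ∎
    where
    k = length (x ∷ y ∷ ys)
    a = ⌊ k /2⌋
    b = ⌈ k /2⌉
    H = halves (x ∷ y ∷ ys)
    T = concatMap (joins (pairwise f)) H

    count : ∀ {P j} → length P ≡ j → 1 ≤ j → j < k → length (pairwise f P) * 2 ^ ε j ≡ j !
    count {P} refl 1≤j j<k = pairwise-count f P (<-≤-trans j<k (s≤s⁻¹ k<f)) 1≤j

    block-count : ∀ {s} → s ∈ H → length (joins (pairwise f) s) * 2 ^ (ε a + ε b) ≡ a ! * b !
    block-count {P , Q} PQ∈ with p , lenP ← halves-sound x (y ∷ ys) PQ∈ = begin
      length (cartesianProductWith node (pairwise f P) (pairwise f Q)) * 2 ^ (ε a + ε b)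
        ≡⟨ cong₂ _*_ (length-cartesianProductWith node (pairwise f P) (pairwise f Q))
                     (^-distribˡ-+-* 2 (ε a) (ε b)) ⟩
      (length (pairwise f P) * length (pairwise f Q)) * (2 ^ ε a * 2 ^ ε b)
        ≡⟨ interchange (length (pairwise f P)) _ _ _ ⟩
      (length (pairwise f P) * 2 ^ ε a) * (length (pairwise f Q) * 2 ^ ε b)
        ≡⟨ cong₂ _*_ (count lenP (s≤s z≤n) (⌊n/2⌋<n (suc (length ys))))
                     (count (split-length {P = P} {Q = Q} p lenP) (s≤s z≤n) (⌈n/2⌉<n (length ys))) ⟩
      a ! * b ! ∎

lookup-≅-injective : ∀ {A} {L : List (Tree A)} → AllPairs _≇_ L → ∀ {i j} → lookup L i ≅ lookup L j → i ≡ j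
lookup-≅-injective (_ ∷ _)     {zero}  {zero}  _ = refl
lookup-≅-injective (t≇L ∷ _)   {zero}  {suc j} t≅ = contradiction t≅ (All.lookup t≇L (∈-lookup j))
lookup-≅-injective (t≇L ∷ _)   {suc i} {zero}  ≅t = contradiction (≅-sym ≅t) (All.lookup t≇L (∈-lookup i))
lookup-≅-injective (_ ∷ L≇)    {suc i} {suc j} p  = cong suc (lookup-≅-injective L≇ p)

NumInequivalentPairwise-fromList : ∀ {n} (L : List (Tree (Fin n))) →
  (∀ {t} → t ∈ L → IsSummation n t × IsPairwise t) → AllPairs _≇_ L →
  (∀ (s : PairwiseSummation n) → ∃ λ u → u ∈ L × proj₁ s ≅ u) →
  NumInequivalentPairwise n (length L)
NumInequivalentPairwise-fromList L sound distinct complete =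
  (λ i → lookup L i , sound (∈-lookup i)) ,
  (λ i j ce → lookup-≅-injective distinct (CompEquiv⇒≅ ce)) ,
  λ s → let u , u∈ , s≅u = complete s in
        index u∈ , ≅⇒CompEquiv (subst (proj₁ s ≅_) (lookup-index u∈) s≅u)

corollary14 : (ε : ℕ → ℕ) → ε 1 ≡ 0
    → (∀ m → 1 ≤ m → ε (2 * m) ≡ 2 * ε m + 1)
    → (∀ m → 1 ≤ m → ε (2 * m + 1) ≡ ε m + ε (m + 1))
    → ∀ n → 1 ≤ n
    → NumInequivalentPairwise n (_/_ (n !) (2 ^ ε n) {{m^n≢0 2 (ε n)}})
corollary14 ε ε-one ε-even ε-odd n 1≤n =
  subst (NumInequivalentPairwise n) length≡ (NumInequivalentPairwise-fromList L sound distinct complete)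
  where
  L = pairwise (suc n) (allFin n)

  length-allFin : length (allFin n) ≡ n
  length-allFin = length-tabulate (λ i → i)

  fuel : length (allFin n) < suc n
  fuel = s≤s (≤-reflexive length-allFin)

  sound : ∀ {t} → t ∈ L → IsSummation n t × IsPairwise t
  sound t∈ = swap (pairwise-sound (suc n) (allFin n) t∈)

  distinct : AllPairs _≇_ L
  distinct = pairwise-distinct (suc n) (allFin⁺ n)

  complete : ∀ (s : PairwiseSummation n) → ∃ λ u → u ∈ L × proj₁ s ≅ u
  complete (t , t↭ , pw) = pairwise-complete (suc n) pw t↭ fuel

  count : length L * 2 ^ ε n ≡ n !
  count = subst (λ m → length L * 2 ^ ε m ≡ m !) length-allFin
    (pairwise-count ε ε-one (ε-halving ε ε-even ε-odd) (suc n) (allFin n) fuel (subst (1 ≤_) (sym length-allFin) 1≤n))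

  length≡ : length L ≡ (n ! / 2 ^ ε n) {{m^n≢0 2 (ε n)}}
  length≡ = trans (sym (m*n/n≡m (length L) (2 ^ ε n) {{m^n≢0 2 (ε n)}}))
                  (cong (λ m → (m / 2 ^ ε n) {{m^n≢0 2 (ε n)}}) count)
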